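{- Let $F$ be a finite simple graph and let $R$ be a set of pendant edges of $F$. Suppose the rooted graph $L(F)_R$ admits a valid decomposition $\mathcal{D}$, and there exist a simple graph $F'$ and an isomorphism $I(\mathcal{D})\cong L(F')$ under which each edge part of $\mathcal{D}$ corresponds to a pendant edge of $F'$. Then $F$ is chordal.
   Context: $L(\cdot)$ denotes the line graph; $L(F)_R$ is $L(F)$ with root set $R$. A pendant edge is an edge with an endpoint of degree $1$. A valid decomposition of a rooted graph $G_R$ is a partition of $E(G)$ into parts each a triangle or a single edge (edge part), identified with vertex sets, such that every non-root vertex lies in exactly $3$ parts and every root in exactly $2$ parts. $I(\mathcal{D})$ is the graph on $\mathcal{D}$ in which two parts are adjacent iff they intersect. -}

module Defs where

open import Level using (0ℓ)
open import Data.Nat as ℕ using (ℕ; zero; suc; _≤_)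
open import Data.Fin using (Fin; zero; suc; toℕ; inject₁; fromℕ; _<_)
open import Data.Bool using (Bool; true; false)
open import Data.Product using (Σ; _×_; _,_; ∃; ∃-syntax; proj₁; proj₂)
open import Data.Sum using (_⊎_)
open import Relation.Nullary using (¬_)
open import Relation.Binary.PropositionalEquality using (_≡_; _≢_)
open import Function.Bundles using (_↔_; _⇔_; Inverse)
open import Function.Definitions using (Injective)

record Graph : Set where
  field
    n      : ℕ
    adj    : Fin n → Fin n → Bool
    sym    : ∀ u v → adj u v ≡ adj v u
    irrefl : ∀ v → adj v v ≡ false

open Graph public

Edge : Graph → Set
Edge F = Σ (Fin (n F) × Fin (n F)) λ p →
           (proj₁ p < proj₂ p) × (adj F (proj₁ p) (proj₂ p) ≡ true)

src tgt : {F : Graph} → Edge F → Fin (n F)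
src ((u , _) , _) = u
tgt ((_ , v) , _) = v

_isEndOf_ : {F : Graph} → Fin (n F) → Edge F → Set
_isEndOf_ {F} w e = w ≡ src {F} e ⊎ w ≡ tgt {F} e

-- u has degree exactly 1, its unique neighbour being v (given u ~ v)
DegOneVia : (F : Graph) → Fin (n F) → Fin (n F) → Set
DegOneVia F u v = ∀ w → adj F u w ≡ true → w ≡ v

Pendant : {F : Graph} → Edge F → Set
Pendant {F} e = DegOneVia F (src {F} e) (tgt {F} e) ⊎ DegOneVia F (tgt {F} e) (src {F} e)

-- Chordality: every cycle of length ≥ 4 has a chord.
-- A cycle of length m+1 is an injective c : Fin (suc m) → vertices with
-- c i ~ c (i+1) for i < m and c m ~ c 0.

CycAdjacent : (m : ℕ) → Fin (suc m) → Fin (suc m) → Set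
CycAdjacent m i j =
  toℕ j ≡ suc (toℕ i) ⊎ toℕ i ≡ suc (toℕ j)
  ⊎ (toℕ i ≡ m × toℕ j ≡ 0) ⊎ (toℕ j ≡ m × toℕ i ≡ 0)

IsCycle : (F : Graph) (m : ℕ) → (Fin (suc m) → Fin (n F)) → Set
IsCycle F m c =
  Injective _≡_ _≡_ c
  × (∀ (i : Fin m) → adj F (c (inject₁ i)) (c (suc i)) ≡ true)
  × adj F (c (fromℕ m)) (c zero) ≡ true

HasChord : (F : Graph) (m : ℕ) → (Fin (suc m) → Fin (n F)) → Set
HasChord F m c = ∃[ i ] ∃[ j ] (¬ CycAdjacent m i j × adj F (c i) (c j) ≡ true)

Chordal : Graph → Set
Chordal F = ∀ m → 3 ≤ m → (c : Fin (suc m) → Fin (n F)) →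
            IsCycle F m c → HasChord F m c

record SGraph : Set₁ where
  field
    V       : Set
    _~_     : V → V → Set
    ~-sym   : ∀ {x y} → x ~ y → y ~ x
    ~-irrefl : ∀ {x} → ¬ (x ~ x)

open SGraph public

L : Graph → SGraph
L F = record
  { V = Edge F
  ; _~_ = λ e f → e ≢ f × ∃[ w ] (_isEndOf_ {F} w e × _isEndOf_ {F} w f)
  ; ~-sym = λ { (ne , w , a , b) → (λ p → ne (Relation.Binary.PropositionalEquality.sym p)) , w , b , a }
  ; ~-irrefl = λ { (ne , _) → ne Relation.Binary.PropositionalEquality.refl }
  }

data Part (G : SGraph) : Set where
  edgePart : (x y : V G) → _~_ G x y → Part G
  triPart  : (x y z : V G) → _~_ G x y → _~_ G y z → _~_ G x z → Part G

_∈P_ : {G : SGraph} → V G → Part G → Set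
v ∈P edgePart x y _ = v ≡ x ⊎ v ≡ y
v ∈P triPart x y z _ _ _ = v ≡ x ⊎ v ≡ y ⊎ v ≡ z

IsEdgePart : {G : SGraph} → Part G → Set
IsEdgePart (edgePart _ _ _) = Data.Unit.⊤ where import Data.Unit
IsEdgePart (triPart _ _ _ _ _ _) = Data.Empty.⊥ where import Data.Empty

record ValidDecomp (G : SGraph) (Root : V G → Set) : Set₁ where
  field
    k      : ℕ
    part   : Fin k → Part G
    cover  : ∀ x y → _~_ G x y →
             (Σ (Fin k) λ i → x ∈P part i × y ∈P part i) ↔ Fin 1
    rootDeg    : ∀ v → Root v → (Σ (Fin k) λ i → v ∈P part i) ↔ Fin 2
    nonRootDeg : ∀ v → ¬ Root v → (Σ (Fin k) λ i → v ∈P part i) ↔ Fin 3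

open ValidDecomp public

I : {G : SGraph} {Root : V G → Set} → ValidDecomp G Root → SGraph
I {G} D = record
  { V = Fin (k D)
  ; _~_ = λ i j → i ≢ j × ∃[ v ] (_∈P_ {G} v (part D i) × _∈P_ {G} v (part D j))
  ; ~-sym = λ { (ne , v , a , b) → (λ p → ne (Relation.Binary.PropositionalEquality.sym p)) , v , b , a }
  ; ~-irrefl = λ { (ne , _) → ne Relation.Binary.PropositionalEquality.refl }
  }

record _≅_ (G H : SGraph) : Set₁ where
  field
    bij      : V G ↔ V H
    preserve : ∀ a b → _~_ G a b ⇔ _~_ H (Inverse.to bij a) (Inverse.to bij b)

open _≅_ public

{-# OPTIONS --safe #-}
module Submission where

-- Take five consecutive vertices a₀ … a₄ of a chordless cycle of F and the edges
-- Eᵢ = aᵢaᵢ₊₁. The parts A, T, B covering E₀E₁, E₁E₂, E₂E₃ are stars at a₁, a₂, a₃, so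
-- A and B are disjoint. In L(F′) their images are therefore non-adjacent neighbours of
-- the image t of T, attached at different ends wA and wB of t; as the neighbours of a
-- pendant edge pairwise meet, t is not pendant, so T is a triangle {E₁, E₂, f}. Neither
-- E₁ nor E₂ is pendant, so neither is a root, and they lie in third parts A′ and B′; A′
-- misses B and B′ misses A, so A′ is attached to t at wA and B′ at wB. Finally f lies in
-- a part S ≠ T whose image is attached to t at wA, say; then S meets both A and A′,
-- which produces an edge of F adjacent in L(F) to all three edges of a triangle of F.

open import Defs
open import Data.Product using (Σ; ∃-syntax)
open import Function.Bundles using (Inverse)

open import Axiom.UniquenessOfIdentityProofs.WithK using (uip)
open import Data.Bool using (true)
import Data.Bool.Properties as Bool
open import Data.Empty using (⊥; ⊥-elim)
open import Data.Fin using (Fin; zero; suc; toℕ; fromℕ; _<_)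
open import Data.Fin.Properties using (_≟_; 0≢1+n; suc-injective; <-cmp; <-irrelevant; <-asym; any?)
import Data.Nat as ℕ
open import Data.Nat using (ℕ; s≤s; z≤n)
open import Data.Product using (_×_; _,_; proj₁; proj₂; ∃)
open import Data.Product.Properties using (Σ-≡,≡→≡)
open import Data.Sum using (_⊎_; inj₁; inj₂; [_,_]; swap)
open import Data.Unit using (tt)
open import Function using (_∘_)
open import Function.Bundles using (_↔_; Equivalence; Injection)
open import Function.Definitions using (Injective)
open import Function.Properties.Inverse using (↔⇒↣; ↔-sym)
open import Relation.Binary.Definitions using (DecidableEquality; tri<; tri≈; tri>)
open import Relation.Binary.PropositionalEquality as ≡ using (_≡_; _≢_; refl; trans; cong; subst; subst₂; ≢-sym)
open import Relation.Nullary using (¬_; Dec; yes; no; Irrelevant)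
open import Relation.Nullary.Decidable using (_×-dec_; _⊎-dec_; ¬?; ¬¬-excluded-middle; decidable-stable)

⊎-irrelevant : {A B : Set} → Irrelevant A → Irrelevant B → (A → ¬ B) → Irrelevant (A ⊎ B)
⊎-irrelevant irrA _ _ (inj₁ a) (inj₁ a′) = cong inj₁ (irrA a a′)
⊎-irrelevant _ irrB _ (inj₂ b) (inj₂ b′) = cong inj₂ (irrB b b′)
⊎-irrelevant _ _ disjoint (inj₁ a) (inj₂ b) = ⊥-elim (disjoint a b)
⊎-irrelevant _ _ disjoint (inj₂ b) (inj₁ a) = ⊥-elim (disjoint a b)

module _ {A : Set} {P : A → Set} {m : ℕ} (count : Σ A P ↔ Fin m) where

  counted : Fin m → A
  counted = proj₁ ∘ Inverse.from count

  counted-satisfies : ∀ i → P (counted i)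
  counted-satisfies = proj₂ ∘ Inverse.from count

  counted-injective : (∀ {a} → Irrelevant (P a)) → Injective _≡_ _≡_ counted
  counted-injective P-irrelevant eq =
    Injection.injective (↔⇒↣ (↔-sym count)) (Σ-≡,≡→≡ (eq , P-irrelevant _ _))

apart-from-f₀ : {A : Set} {k : ℕ} (f : Fin (ℕ.suc k) → A) → Injective _≡_ _≡_ f →
                ∀ {i u} → f zero ≡ u → f (suc i) ≢ u
apart-from-f₀ f f-injective f₀≡u fᵢ≡u = 0≢1+n (f-injective (trans f₀≡u (≡.sym fᵢ≡u)))

counted-once : {A : Set} {P : A → Set} → Σ A P ↔ Fin 1 → (x y : Σ A P) → x ≡ y
counted-once count x y = Injection.injective (↔⇒↣ count) (Fin1-trivial _ _)
  where
  Fin1-trivial : (i j : Fin 1) → i ≡ j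
  Fin1-trivial zero zero = refl

module _ {A : Set} (_≟ᴬ_ : DecidableEquality A) {m : ℕ} where

  injective-avoids-one : (f : Fin (2 ℕ.+ m) → A) → Injective _≡_ _≡_ f →
                         ∀ t → ∃ λ i → f i ≢ t
  injective-avoids-one f f-injective t with f zero ≟ᴬ t
  ... | no f₀≢t = zero , f₀≢t
  ... | yes f₀≡t = suc zero , apart-from-f₀ f f-injective f₀≡t

  injective-avoids-two : (f : Fin (3 ℕ.+ m) → A) → Injective _≡_ _≡_ f →
                         ∀ s t → ∃ λ i → f i ≢ s × f i ≢ t
  injective-avoids-two f f-injective s t with f zero ≟ᴬ s | f zero ≟ᴬ t
  ... | no f₀≢s | no f₀≢t = zero , f₀≢s , f₀≢t
  ... | yes f₀≡s | _ =
    let i , fᵢ≢t = injective-avoids-one (f ∘ suc) (suc-injective ∘ f-injective) t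
    in suc i , apart-from-f₀ f f-injective f₀≡s , fᵢ≢t
  ... | no _ | yes f₀≡t =
    let i , fᵢ≢s = injective-avoids-one (f ∘ suc) (suc-injective ∘ f-injective) s
    in suc i , fᵢ≢s , apart-from-f₀ f f-injective f₀≡t

module _ {G : SGraph} where

  ~⇒≢ : ∀ {x y} → _~_ G x y → x ≢ y
  ~⇒≢ x~y refl = ~-irrefl G x~y

  private
    apart : ∀ {x y v} → _~_ G x y → v ≡ x → v ≢ y
    apart x~y refl = ~⇒≢ x~y

  ∈P-irrelevant : (p : Part G) {v : V G} → Irrelevant (v ∈P p)
  ∈P-irrelevant (edgePart x y x~y) =
    ⊎-irrelevant uip uip (apart x~y)
  ∈P-irrelevant (triPart x y z x~y y~z x~z) =
    ⊎-irrelevant uip (⊎-irrelevant uip uip (apart y~z)) λ v≡x → [ apart x~y v≡x , apart x~z v≡x ]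

  ∈P-adjacent : (p : Part G) {v w : V G} → v ∈P p → w ∈P p → v ≢ w → _~_ G v w
  ∈P-adjacent (edgePart x y x~y) (inj₁ refl) (inj₁ refl) v≢w = ⊥-elim (v≢w refl)
  ∈P-adjacent (edgePart x y x~y) (inj₁ refl) (inj₂ refl) _ = x~y
  ∈P-adjacent (edgePart x y x~y) (inj₂ refl) (inj₁ refl) _ = ~-sym G x~y
  ∈P-adjacent (edgePart x y x~y) (inj₂ refl) (inj₂ refl) v≢w = ⊥-elim (v≢w refl)
  ∈P-adjacent (triPart x y z x~y y~z x~z) (inj₁ refl) (inj₁ refl) v≢w = ⊥-elim (v≢w refl)
  ∈P-adjacent (triPart x y z x~y y~z x~z) (inj₁ refl) (inj₂ (inj₁ refl)) _ = x~y
  ∈P-adjacent (triPart x y z x~y y~z x~z) (inj₁ refl) (inj₂ (inj₂ refl)) _ = x~z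
  ∈P-adjacent (triPart x y z x~y y~z x~z) (inj₂ (inj₁ refl)) (inj₁ refl) _ = ~-sym G x~y
  ∈P-adjacent (triPart x y z x~y y~z x~z) (inj₂ (inj₁ refl)) (inj₂ (inj₁ refl)) v≢w = ⊥-elim (v≢w refl)
  ∈P-adjacent (triPart x y z x~y y~z x~z) (inj₂ (inj₁ refl)) (inj₂ (inj₂ refl)) _ = y~z
  ∈P-adjacent (triPart x y z x~y y~z x~z) (inj₂ (inj₂ refl)) (inj₁ refl) _ = ~-sym G x~z
  ∈P-adjacent (triPart x y z x~y y~z x~z) (inj₂ (inj₂ refl)) (inj₂ (inj₁ refl)) _ = ~-sym G y~z
  ∈P-adjacent (triPart x y z x~y y~z x~z) (inj₂ (inj₂ refl)) (inj₂ (inj₂ refl)) v≢w = ⊥-elim (v≢w refl)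

  part-inhabited : (p : Part G) → ∃ λ v → v ∈P p
  part-inhabited (edgePart x _ _) = x , inj₁ refl
  part-inhabited (triPart x _ _ _ _ _) = x , inj₁ refl

  edgePart-or-third : (p : Part G) {a b : V G} → a ∈P p → b ∈P p → a ≢ b →
                      IsEdgePart p ⊎ ∃ λ c → c ∈P p × c ≢ a × c ≢ b
  edgePart-or-third (edgePart _ _ _) _ _ _ = inj₁ tt
  edgePart-or-third (triPart x y z x~y y~z x~z) (inj₁ refl) (inj₁ refl) a≢b = ⊥-elim (a≢b refl)
  edgePart-or-third (triPart x y z x~y y~z x~z) (inj₁ refl) (inj₂ (inj₁ refl)) _ =
    inj₂ (z , inj₂ (inj₂ refl) , ≢-sym (~⇒≢ x~z) , ≢-sym (~⇒≢ y~z))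
  edgePart-or-third (triPart x y z x~y y~z x~z) (inj₁ refl) (inj₂ (inj₂ refl)) _ =
    inj₂ (y , inj₂ (inj₁ refl) , ≢-sym (~⇒≢ x~y) , ~⇒≢ y~z)
  edgePart-or-third (triPart x y z x~y y~z x~z) (inj₂ (inj₁ refl)) (inj₁ refl) _ =
    inj₂ (z , inj₂ (inj₂ refl) , ≢-sym (~⇒≢ y~z) , ≢-sym (~⇒≢ x~z))
  edgePart-or-third (triPart x y z x~y y~z x~z) (inj₂ (inj₁ refl)) (inj₂ (inj₁ refl)) a≢b = ⊥-elim (a≢b refl)
  edgePart-or-third (triPart x y z x~y y~z x~z) (inj₂ (inj₁ refl)) (inj₂ (inj₂ refl)) _ =
    inj₂ (x , inj₁ refl , ~⇒≢ x~y , ~⇒≢ x~z)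
  edgePart-or-third (triPart x y z x~y y~z x~z) (inj₂ (inj₂ refl)) (inj₁ refl) _ =
    inj₂ (y , inj₂ (inj₁ refl) , ~⇒≢ y~z , ≢-sym (~⇒≢ x~y))
  edgePart-or-third (triPart x y z x~y y~z x~z) (inj₂ (inj₂ refl)) (inj₂ (inj₁ refl)) _ =
    inj₂ (x , inj₁ refl , ~⇒≢ x~z , ~⇒≢ x~y)
  edgePart-or-third (triPart x y z x~y y~z x~z) (inj₂ (inj₂ refl)) (inj₂ (inj₂ refl)) a≢b = ⊥-elim (a≢b refl)

module Edges (F : Graph) where

  Vertex : Set
  Vertex = Fin (n F)

  _∈E_ : Vertex → Edge F → Set
  _∈E_ = _isEndOf_ {F}

  _~L_ : Edge F → Edge F → Set
  _~L_ = _~_ (L F)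

  src<tgt : (e : Edge F) → src {F} e < tgt {F} e
  src<tgt (_ , s<t , _) = s<t

  src~tgt : (e : Edge F) → adj F (src {F} e) (tgt {F} e) ≡ true
  src~tgt (_ , _ , s~t) = s~t

  adj-sym : ∀ {p q} → adj F p q ≡ true → adj F q p ≡ true
  adj-sym {p} {q} = trans (sym F q p)

  adj⇒≢ : ∀ {p q} → adj F p q ≡ true → p ≢ q
  adj⇒≢ {p} p~p refl with trans (≡.sym p~p) (irrefl F p)
  ... | ()

  data Joins (e : Edge F) (p q : Vertex) : Set where
    src-tgt : p ≡ src {F} e → q ≡ tgt {F} e → Joins e p q
    tgt-src : p ≡ tgt {F} e → q ≡ src {F} e → Joins e p q

  joins-sym : ∀ {e p q} → Joins e p q → Joins e q p
  joins-sym (src-tgt p≡s q≡t) = tgt-src q≡t p≡s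
  joins-sym (tgt-src p≡t q≡s) = src-tgt q≡s p≡t

  module _ {e : Edge F} {p q : Vertex} where

    joins-∈ˡ : Joins e p q → p ∈E e
    joins-∈ˡ (src-tgt p≡s _) = inj₁ p≡s
    joins-∈ˡ (tgt-src p≡t _) = inj₂ p≡t

    joins-∈ʳ : Joins e p q → q ∈E e
    joins-∈ʳ (src-tgt _ q≡t) = inj₂ q≡t
    joins-∈ʳ (tgt-src _ q≡s) = inj₁ q≡s

    joins⇒adj : Joins e p q → adj F p q ≡ true
    joins⇒adj (src-tgt refl refl) = src~tgt e
    joins⇒adj (tgt-src refl refl) = adj-sym (src~tgt e)

    joins⇒≢ : Joins e p q → p ≢ q
    joins⇒≢ = adj⇒≢ ∘ joins⇒adj

    ∈-joins : ∀ {r} → Joins e p q → r ∈E e → r ≡ p ⊎ r ≡ q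
    ∈-joins (src-tgt refl refl) r∈e = r∈e
    ∈-joins (tgt-src refl refl) r∈e = swap r∈e

    ∉-joins : ∀ {r} → Joins e p q → r ≢ p → r ≢ q → ¬ r ∈E e
    ∉-joins e-pq r≢p r≢q r∈e = [ r≢p , r≢q ] (∈-joins e-pq r∈e)

  ∈⇒joins : ∀ e {p q} → p ∈E e → q ∈E e → p ≢ q → Joins e p q
  ∈⇒joins _ (inj₁ p≡s) (inj₁ q≡s) p≢q = ⊥-elim (p≢q (trans p≡s (≡.sym q≡s)))
  ∈⇒joins _ (inj₁ p≡s) (inj₂ q≡t) _ = src-tgt p≡s q≡t
  ∈⇒joins _ (inj₂ p≡t) (inj₁ q≡s) _ = tgt-src p≡t q≡s
  ∈⇒joins _ (inj₂ p≡t) (inj₂ q≡t) p≢q = ⊥-elim (p≢q (trans p≡t (≡.sym q≡t)))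

  other-end : ∀ {e p} → p ∈E e → ∃ λ q → Joins e p q
  other-end {e} (inj₁ p≡s) = tgt {F} e , src-tgt p≡s refl
  other-end {e} (inj₂ p≡t) = src {F} e , tgt-src p≡t refl

  edge-≡ : ∀ {e g} → src {F} e ≡ src {F} g → tgt {F} e ≡ tgt {F} g → e ≡ g
  edge-≡ {_ , s<t , st} {_ , s<t′ , st′} refl refl
    rewrite <-irrelevant s<t s<t′ | uip st st′ = refl

  joins-injective : ∀ {e g p q} → Joins e p q → Joins g p q → e ≡ g
  joins-injective (src-tgt refl refl) (src-tgt p≡s q≡t) = edge-≡ p≡s q≡t
  joins-injective (tgt-src refl refl) (tgt-src p≡t q≡s) = edge-≡ q≡s p≡t
  joins-injective {e} {g} (src-tgt refl refl) (tgt-src p≡t q≡s) =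
    ⊥-elim (<-asym (src<tgt e) (subst₂ _<_ (≡.sym q≡s) (≡.sym p≡t) (src<tgt g)))
  joins-injective {e} {g} (tgt-src refl refl) (src-tgt p≡s q≡t) =
    ⊥-elim (<-asym (src<tgt e) (subst₂ _<_ (≡.sym p≡s) (≡.sym q≡t) (src<tgt g)))

  edgeBetween : ∀ {p q} → adj F p q ≡ true → ∃ λ e → Joins e p q
  edgeBetween {p} {q} p~q with <-cmp p q
  ... | tri< p<q _ _ = ((p , q) , p<q , p~q) , src-tgt refl refl
  ... | tri≈ _ p≡q _ = ⊥-elim (adj⇒≢ p~q p≡q)
  ... | tri> _ _ q<p = ((q , p) , q<p , adj-sym p~q) , tgt-src refl refl

  _≟E_ : DecidableEquality (Edge F)
  e ≟E g with src {F} e ≟ src {F} g | tgt {F} e ≟ tgt {F} g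
  ... | yes s≡s | yes t≡t = yes (edge-≡ s≡s t≡t)
  ... | no s≢s | _ = no (s≢s ∘ cong (src {F}))
  ... | yes _ | no t≢t = no (t≢t ∘ cong (tgt {F}))

  ∋-ends⇒adj : ∀ g {p q} → p ∈E g → q ∈E g → p ≢ q → adj F p q ≡ true
  ∋-ends⇒adj g p∈g q∈g p≢q = joins⇒adj (∈⇒joins g p∈g q∈g p≢q)

  ∋-ends⇒≡ : ∀ g {e p q} → p ∈E g → q ∈E g → Joins e p q → g ≡ e
  ∋-ends⇒≡ g p∈g q∈g e-pq = joins-injective (∈⇒joins g p∈g q∈g (joins⇒≢ e-pq)) e-pq

  L-neighbour-∋-end : ∀ {e g p q} → Joins e p q → g ~L e → p ∈E g ⊎ q ∈E g
  L-neighbour-∋-end e-pq (_ , w , w∈g , w∈e) with ∈-joins e-pq w∈e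
  ... | inj₁ refl = inj₁ w∈g
  ... | inj₂ refl = inj₂ w∈g

  joins⇒~L : ∀ {e g p q r} → Joins e p q → Joins g q r → p ≢ r → e ~L g
  joins⇒~L {r = r} e-pq g-qr p≢r =
    (λ e≡g → ∉-joins e-pq (≢-sym p≢r) (≢-sym (joins⇒≢ g-qr))
                     (subst (r ∈E_) (≡.sym e≡g) (joins-∈ʳ g-qr)))
    , _ , joins-∈ʳ e-pq , joins-∈ˡ g-qr

  both-ends-extend⇒¬pendant : ∀ {e p q p′ q′} → Joins e p q →
    adj F p p′ ≡ true → p′ ≢ q → adj F q q′ ≡ true → q′ ≢ p → ¬ Pendant {F} e
  both-ends-extend⇒¬pendant (src-tgt refl refl) p~p′ p′≢q _ _ (inj₁ deg) = p′≢q (deg _ p~p′)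
  both-ends-extend⇒¬pendant (src-tgt refl refl) _ _ q~q′ q′≢p (inj₂ deg) = q′≢p (deg _ q~q′)
  both-ends-extend⇒¬pendant (tgt-src refl refl) _ _ q~q′ q′≢p (inj₁ deg) = q′≢p (deg _ q~q′)
  both-ends-extend⇒¬pendant (tgt-src refl refl) p~p′ p′≢q _ _ (inj₂ deg) = p′≢q (deg _ p~p′)

  L-neighbour-of-pendant-∋-hub : ∀ {g h u v} → DegOneVia F u v → Joins g u v → h ~L g → v ∈E h
  L-neighbour-of-pendant-∋-hub deg g-uv (h≢g , w , w∈h , w∈g) with ∈-joins g-uv w∈g
  ... | inj₂ refl = w∈h
  ... | inj₁ refl with other-end w∈h
  ...   | y , h-uy with deg y (joins⇒adj h-uy)
  ...     | refl = ⊥-elim (h≢g (joins-injective h-uy g-uv))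

  pendant-L-neighbours-meet : ∀ {g h h′} → Pendant {F} g → h ~L g → h′ ~L g →
                              ∃ λ w → w ∈E h × w ∈E h′
  pendant-L-neighbours-meet {g} (inj₁ deg) h~g h′~g =
    tgt {F} g , L-neighbour-of-pendant-∋-hub deg (src-tgt refl refl) h~g
              , L-neighbour-of-pendant-∋-hub deg (src-tgt refl refl) h′~g
  pendant-L-neighbours-meet {g} (inj₂ deg) h~g h′~g =
    src {F} g , L-neighbour-of-pendant-∋-hub deg (tgt-src refl refl) h~g
              , L-neighbour-of-pendant-∋-hub deg (tgt-src refl refl) h′~g

  ¬common-L-neighbour-of-triangle : ∀ {e f x z c d r} →
    Joins e c d → Joins f c r → Joins x d r → z ~L e → z ~L f → z ~L x → ⊥
  ¬common-L-neighbour-of-triangle {z = z} e-cd f-cr x-dr z~e z~f z~x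
    with L-neighbour-∋-end e-cd z~e | L-neighbour-∋-end f-cr z~f | L-neighbour-∋-end x-dr z~x
  ... | inj₁ c∈z | _ | inj₁ d∈z = proj₁ z~e (∋-ends⇒≡ z c∈z d∈z e-cd)
  ... | inj₁ c∈z | _ | inj₂ r∈z = proj₁ z~f (∋-ends⇒≡ z c∈z r∈z f-cr)
  ... | inj₂ d∈z | inj₁ c∈z | _ = proj₁ z~e (∋-ends⇒≡ z c∈z d∈z e-cd)
  ... | inj₂ d∈z | inj₂ r∈z | _ = proj₁ z~x (∋-ends⇒≡ z d∈z r∈z x-dr)

  -- a₄ = a₀ is allowed: a chordless 4-cycle gives such a closed walk.
  record ShortcutFreeWalk₄ : Set where
    field
      a₀ a₁ a₂ a₃ a₄ : Vertex
      a₀~a₁ : adj F a₀ a₁ ≡ true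
      a₁~a₂ : adj F a₁ a₂ ≡ true
      a₂~a₃ : adj F a₂ a₃ ≡ true
      a₃~a₄ : adj F a₃ a₄ ≡ true
      a₀≢a₂ : a₀ ≢ a₂
      a₁≢a₃ : a₁ ≢ a₃
      a₂≢a₄ : a₂ ≢ a₄
      a₀≁a₂ : adj F a₀ a₂ ≢ true
      a₁≁a₃ : adj F a₁ a₃ ≢ true
      a₂≁a₄ : adj F a₂ a₄ ≢ true

module Decomposition (F : Graph) (R : Edge F → Set) (D : ValidDecomp (L F) R) where
  open Edges F

  _∈_ : Edge F → Fin (k D) → Set
  e ∈ i = e ∈P part D i

  Meet : Fin (k D) → Fin (k D) → Set
  Meet i j = ∃ λ e → e ∈ i × e ∈ j

  coveringPart : ∀ {e g} → e ~L g → ∃ λ i → e ∈ i × g ∈ i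
  coveringPart {e} {g} e~g = Inverse.from (cover D e g e~g) zero

  covering-unique : ∀ {e g} → e ~L g → ∀ {i j} → e ∈ i → g ∈ i → e ∈ j → g ∈ j → i ≡ j
  covering-unique {e} {g} e~g e∈i g∈i e∈j g∈j =
    cong proj₁ (counted-once (cover D e g e~g) (_ , e∈i , g∈i) (_ , e∈j , g∈j))

  ∈-adjacent : ∀ {e g i} → e ∈ i → g ∈ i → e ≢ g → e ~L g
  ∈-adjacent {i = i} = ∈P-adjacent (part D i)

  private
    partsContaining-injective : ∀ {e m} (count : Σ (Fin (k D)) (e ∈_) ↔ Fin m) →
                                Injective _≡_ _≡_ (counted count)
    partsContaining-injective count = counted-injective count λ {i} → ∈P-irrelevant (part D i)

    anotherCounted : ∀ {e m} (count : Σ (Fin (k D)) (e ∈_) ↔ Fin (2 ℕ.+ m)) →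
                     ∀ T → ∃ λ S → S ≢ T × e ∈ S
    anotherCounted count T =
      let i , Sᵢ≢T = injective-avoids-one _≟_ _ (partsContaining-injective count) T
      in _ , Sᵢ≢T , counted-satisfies count i

  anotherPart : ∀ {e} → Dec (R e) → ∀ T → ∃ λ S → S ≢ T × e ∈ S
  anotherPart {e} (yes root) = anotherCounted (rootDeg D e root)
  anotherPart {e} (no nonRoot) = anotherCounted (nonRootDeg D e nonRoot)

  twoMoreParts : ∀ {e} → ¬ R e → ∀ X T → ∃ λ Y → Y ≢ X × Y ≢ T × e ∈ Y
  twoMoreParts {e} nonRoot X T =
    let count = nonRootDeg D e nonRoot
        i , Yᵢ≢X , Yᵢ≢T = injective-avoids-two _≟_ _ (partsContaining-injective count) X T
    in _ , Yᵢ≢X , Yᵢ≢T , counted-satisfies count i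

  star-part : ∀ {X e e′ p q r} → Joins e p q → Joins e′ q r → p ≢ r → adj F p r ≢ true →
              e ∈ X → e′ ∈ X → ∀ {g} → g ∈ X → q ∈E g
  star-part {e = e} {e′} e-pq e′-qr p≢r p≁r e∈X e′∈X {g} g∈X with g ≟E e | g ≟E e′
  ... | yes refl | _ = joins-∈ʳ e-pq
  ... | no _ | yes refl = joins-∈ˡ e′-qr
  ... | no g≢e | no g≢e′
      with L-neighbour-∋-end e-pq (∈-adjacent g∈X e∈X g≢e)
         | L-neighbour-∋-end e′-qr (∈-adjacent g∈X e′∈X g≢e′)
  ...   | inj₂ q∈g | _ = q∈g
  ...   | inj₁ _ | inj₁ q∈g = q∈g
  ...   | inj₁ p∈g | inj₂ r∈g = ⊥-elim (p≁r (∋-ends⇒adj g p∈g r∈g p≢r))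

  far-end-avoids-other-parts : ∀ {T Y e e′ p q r g} → Joins e p q → Joins e′ q r →
    p ≢ r → adj F p r ≢ true → e ∈ T → e′ ∈ T → e ∈ Y → Y ≢ T → g ∈ Y → ¬ r ∈E g
  far-end-avoids-other-parts {Y = Y} {e = e} {e′} {g = g} e-pq e′-qr p≢r p≁r e∈T e′∈T e∈Y Y≢T g∈Y r∈g
    with g ≟E e
  ... | yes refl = ∉-joins e-pq (≢-sym p≢r) (≢-sym (joins⇒≢ e′-qr)) r∈g
  ... | no g≢e with L-neighbour-∋-end e-pq (∈-adjacent g∈Y e∈Y g≢e)
  ...   | inj₁ p∈g = p≁r (∋-ends⇒adj g p∈g r∈g p≢r)
  ...   | inj₂ q∈g = Y≢T (covering-unique (joins⇒~L e-pq e′-qr p≢r) e∈Y e′∈Y e∈T e′∈T)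
    where
    e′∈Y : e′ ∈ Y
    e′∈Y = subst (_∈ Y) (∋-ends⇒≡ g q∈g r∈g e′-qr) g∈Y

  -- A member x of S ∩ X spans with e and f a triangle c d r of F, and a member of S ∩ Y
  -- would be adjacent in L(F) to all three of its edges.
  ¬meets-both : ∀ {e c d T f X Y S} → Joins e c d → e ∈ T → f ∈ T → f ≢ e → c ∈E f →
    e ∈ X → X ≢ T → (∀ {g} → g ∈ X → d ∈E g) → e ∈ Y → Y ≢ T → Y ≢ X →
    f ∈ S → S ≢ T → Meet S X → Meet S Y → ⊥
  ¬meets-both {e} {c} {d} {T} {f} {X} {Y} {S} e-cd e∈T f∈T f≢e c∈f e∈X X≢T X-star e∈Y Y≢T Y≢X
              f∈S S≢T (x , x∈S , x∈X) (z , z∈S , z∈Y) =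
    let _ , _ , r∈x , r∈f = ∈-adjacent x∈S f∈S x≢f in triangle r∈x r∈f
    where
    same-part : ∀ {i j} → e ∈ i → f ∈ i → e ∈ j → f ∈ j → i ≡ j
    same-part = covering-unique (≢-sym f≢e , c , joins-∈ˡ e-cd , c∈f)

    x≢f : x ≢ f
    x≢f x≡f = X≢T (same-part e∈X (subst (_∈ X) x≡f x∈X) e∈T f∈T)
    x≢e : x ≢ e
    x≢e x≡e = S≢T (same-part (subst (_∈ S) x≡e x∈S) f∈S e∈T f∈T)
    z≢e : z ≢ e
    z≢e z≡e = S≢T (same-part (subst (_∈ S) z≡e z∈S) f∈S e∈T f∈T)
    z≢f : z ≢ f
    z≢f z≡f = Y≢T (same-part e∈Y (subst (_∈ Y) z≡f z∈Y) e∈T f∈T)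
    z≢x : z ≢ x
    z≢x z≡x = Y≢X (covering-unique (∈-adjacent x∈X e∈X x≢e) (subst (_∈ Y) z≡x z∈Y) e∈Y x∈X e∈X)

    triangle : ∀ {r} → r ∈E x → r ∈E f → ⊥
    triangle {r} r∈x r∈f =
      ¬common-L-neighbour-of-triangle e-cd f-cr x-dr
        (∈-adjacent z∈Y e∈Y z≢e) (∈-adjacent z∈S f∈S z≢f) (∈-adjacent z∈S x∈S z≢x)
      where
      r≢d : r ≢ d
      r≢d r≡d = f≢e (∋-ends⇒≡ f c∈f (subst (_∈E f) r≡d r∈f) e-cd)
      r≢c : r ≢ c
      r≢c r≡c = x≢e (∋-ends⇒≡ x (subst (_∈E x) r≡c r∈x) (X-star x∈X) e-cd)
      x-dr : Joins x d r
      x-dr = ∈⇒joins x (X-star x∈X) r∈x (≢-sym r≢d)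
      f-cr : Joins f c r
      f-cr = ∈⇒joins f c∈f r∈f (≢-sym r≢c)

module IntersectionGraphIsLineGraph
  (F : Graph) (R : Edge F → Set) (roots-pendant : ∀ e → R e → Pendant {F} e)
  (D : ValidDecomp (L F) R) (F′ : Graph) (φ : I {L F} {R} D ≅ L F′)
  (edgeParts-pendant : ∀ i → IsEdgePart (part D i) → Pendant {F′} (Inverse.to (bij φ) i))
  where
  open Edges F
  open Decomposition F R D
  module F′ = Edges F′

  image : Fin (k D) → Edge F′
  image = Inverse.to (bij φ)

  image-~L : ∀ {X Y} → X ≢ Y → Meet X Y → image X F′.~L image Y
  image-~L {X} {Y} X≢Y X∩Y = Equivalence.to (preserve φ X Y) (X≢Y , X∩Y)

  sharedEnd : ∀ {X Y} → X ≢ Y → Meet X Y → ∃ λ w → w F′.∈E image X × w F′.∈E image Y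
  sharedEnd X≢Y X∩Y = proj₂ (image-~L X≢Y X∩Y)

  common-end⇒meet : ∀ {X Y w} → w F′.∈E image X → w F′.∈E image Y → Meet X Y
  common-end⇒meet {X} {Y} {w} w∈X w∈Y with X ≟ Y
  ... | yes refl = let v , v∈X = part-inhabited (part D X) in v , v∈X , v∈X
  ... | no X≢Y = proj₂ (Equivalence.from (preserve φ X Y) (image-≢ , w , w∈X , w∈Y))
    where
    image-≢ : image X ≢ image Y
    image-≢ = X≢Y ∘ Injection.injective (↔⇒↣ (bij φ))

  module Walk (W : ShortcutFreeWalk₄) where
    open ShortcutFreeWalk₄ W

    E₀ E₁ E₂ E₃ : Edge F
    E₀ = proj₁ (edgeBetween a₀~a₁)
    E₁ = proj₁ (edgeBetween a₁~a₂)
    E₂ = proj₁ (edgeBetween a₂~a₃)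
    E₃ = proj₁ (edgeBetween a₃~a₄)

    E₀-a₀a₁ : Joins E₀ a₀ a₁
    E₀-a₀a₁ = proj₂ (edgeBetween a₀~a₁)
    E₁-a₁a₂ : Joins E₁ a₁ a₂
    E₁-a₁a₂ = proj₂ (edgeBetween a₁~a₂)
    E₂-a₂a₃ : Joins E₂ a₂ a₃
    E₂-a₂a₃ = proj₂ (edgeBetween a₂~a₃)
    E₃-a₃a₄ : Joins E₃ a₃ a₄
    E₃-a₃a₄ = proj₂ (edgeBetween a₃~a₄)

    private
      part₀₁ : ∃ λ i → E₀ ∈ i × E₁ ∈ i
      part₀₁ = coveringPart (joins⇒~L E₀-a₀a₁ E₁-a₁a₂ a₀≢a₂)
      part₁₂ : ∃ λ i → E₁ ∈ i × E₂ ∈ i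
      part₁₂ = coveringPart (joins⇒~L E₁-a₁a₂ E₂-a₂a₃ a₁≢a₃)
      part₂₃ : ∃ λ i → E₂ ∈ i × E₃ ∈ i
      part₂₃ = coveringPart (joins⇒~L E₂-a₂a₃ E₃-a₃a₄ a₂≢a₄)

    A T B : Fin (k D)
    A = proj₁ part₀₁
    T = proj₁ part₁₂
    B = proj₁ part₂₃

    E₀∈A : E₀ ∈ A
    E₀∈A = proj₁ (proj₂ part₀₁)
    E₁∈A : E₁ ∈ A
    E₁∈A = proj₂ (proj₂ part₀₁)
    E₁∈T : E₁ ∈ T
    E₁∈T = proj₁ (proj₂ part₁₂)
    E₂∈T : E₂ ∈ T
    E₂∈T = proj₂ (proj₂ part₁₂)
    E₂∈B : E₂ ∈ B
    E₂∈B = proj₁ (proj₂ part₂₃)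
    E₃∈B : E₃ ∈ B
    E₃∈B = proj₂ (proj₂ part₂₃)

    A-star : ∀ {g} → g ∈ A → a₁ ∈E g
    A-star = star-part E₀-a₀a₁ E₁-a₁a₂ a₀≢a₂ a₀≁a₂ E₀∈A E₁∈A
    T-star : ∀ {g} → g ∈ T → a₂ ∈E g
    T-star = star-part E₁-a₁a₂ E₂-a₂a₃ a₁≢a₃ a₁≁a₃ E₁∈T E₂∈T
    B-star : ∀ {g} → g ∈ B → a₃ ∈E g
    B-star = star-part (joins-sym E₃-a₃a₄) (joins-sym E₂-a₂a₃) (≢-sym a₂≢a₄) (a₂≁a₄ ∘ adj-sym) E₃∈B E₂∈B

    ¬Meet-A-B : ¬ Meet A B
    ¬Meet-A-B (g , g∈A , g∈B) = a₁≁a₃ (∋-ends⇒adj g (A-star g∈A) (B-star g∈B) a₁≢a₃)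

    A≢T : A ≢ T
    A≢T A≡T = ∉-joins E₂-a₂a₃ (adj⇒≢ a₁~a₂) a₁≢a₃ (A-star (subst (E₂ ∈_) (≡.sym A≡T) E₂∈T))
    B≢T : B ≢ T
    B≢T B≡T = ∉-joins E₁-a₁a₂ (≢-sym a₁≢a₃) (≢-sym (adj⇒≢ a₂~a₃)) (B-star (subst (E₁ ∈_) (≡.sym B≡T) E₁∈T))

    E₁-nonRoot : ¬ R E₁
    E₁-nonRoot = both-ends-extend⇒¬pendant E₁-a₁a₂ (adj-sym a₀~a₁) a₀≢a₂ a₂~a₃ (≢-sym a₁≢a₃) ∘ roots-pendant E₁
    E₂-nonRoot : ¬ R E₂
    E₂-nonRoot = both-ends-extend⇒¬pendant E₂-a₂a₃ (adj-sym a₁~a₂) a₁≢a₃ a₃~a₄ (≢-sym a₂≢a₄) ∘ roots-pendant E₂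

    private
      third₁ : ∃ λ Y → Y ≢ A × Y ≢ T × E₁ ∈ Y
      third₁ = twoMoreParts E₁-nonRoot A T
      third₂ : ∃ λ Y → Y ≢ B × Y ≢ T × E₂ ∈ Y
      third₂ = twoMoreParts E₂-nonRoot B T

    A′ B′ : Fin (k D)
    A′ = proj₁ third₁
    B′ = proj₁ third₂

    A′≢A : A′ ≢ A
    A′≢A = proj₁ (proj₂ third₁)
    A′≢T : A′ ≢ T
    A′≢T = proj₁ (proj₂ (proj₂ third₁))
    E₁∈A′ : E₁ ∈ A′
    E₁∈A′ = proj₂ (proj₂ (proj₂ third₁))
    B′≢B : B′ ≢ B
    B′≢B = proj₁ (proj₂ third₂)
    B′≢T : B′ ≢ T
    B′≢T = proj₁ (proj₂ (proj₂ third₂))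
    E₂∈B′ : E₂ ∈ B′
    E₂∈B′ = proj₂ (proj₂ (proj₂ third₂))

    ¬Meet-A′-B : ¬ Meet A′ B
    ¬Meet-A′-B (g , g∈A′ , g∈B) =
      far-end-avoids-other-parts E₁-a₁a₂ E₂-a₂a₃ a₁≢a₃ a₁≁a₃ E₁∈T E₂∈T E₁∈A′ A′≢T g∈A′ (B-star g∈B)
    ¬Meet-B′-A : ¬ Meet B′ A
    ¬Meet-B′-A (g , g∈B′ , g∈A) =
      far-end-avoids-other-parts (joins-sym E₂-a₂a₃) (joins-sym E₁-a₁a₂) (≢-sym a₁≢a₃) (a₁≁a₃ ∘ adj-sym)
                                 E₂∈T E₁∈T E₂∈B′ B′≢T g∈B′ (A-star g∈A)

    T-not-edgePart : ¬ IsEdgePart (part D T)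
    T-not-edgePart T-edge =
      let w , w∈A , w∈B = F′.pendant-L-neighbours-meet (edgeParts-pendant T T-edge)
                            (image-~L A≢T (E₁ , E₁∈A , E₁∈T)) (image-~L B≢T (E₂ , E₂∈B , E₂∈T))
      in ¬Meet-A-B (common-end⇒meet w∈A w∈B)

    private
      end-A : ∃ λ w → w F′.∈E image A × w F′.∈E image T
      end-A = sharedEnd A≢T (E₁ , E₁∈A , E₁∈T)
      end-B : ∃ λ w → w F′.∈E image B × w F′.∈E image T
      end-B = sharedEnd B≢T (E₂ , E₂∈B , E₂∈T)

    wA wB : F′.Vertex
    wA = proj₁ end-A
    wB = proj₁ end-B

    wA∈A : wA F′.∈E image A
    wA∈A = proj₁ (proj₂ end-A)
    wB∈B : wB F′.∈E image B
    wB∈B = proj₁ (proj₂ end-B)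

    T-wAwB : F′.Joins (image T) wA wB
    T-wAwB = F′.∈⇒joins (image T) (proj₂ (proj₂ end-A)) (proj₂ (proj₂ end-B)) wA≢wB
      where
      wA≢wB : wA ≢ wB
      wA≢wB wA≡wB = ¬Meet-A-B (common-end⇒meet wA∈A (subst (F′._∈E image B) (≡.sym wA≡wB) wB∈B))

    A′-at-wA : wA F′.∈E image A′
    A′-at-wA with F′.L-neighbour-∋-end T-wAwB (image-~L A′≢T (E₁ , E₁∈A′ , E₁∈T))
    ... | inj₁ wA∈A′ = wA∈A′
    ... | inj₂ wB∈A′ = ⊥-elim (¬Meet-A′-B (common-end⇒meet wB∈A′ wB∈B))

    B′-at-wB : wB F′.∈E image B′
    B′-at-wB with F′.L-neighbour-∋-end T-wAwB (image-~L B′≢T (E₂ , E₂∈B′ , E₂∈T))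
    ... | inj₁ wA∈B′ = ⊥-elim (¬Meet-B′-A (common-end⇒meet wA∈B′ wA∈A))
    ... | inj₂ wB∈B′ = wB∈B′

    third-member-in-no-other-part : ∀ {f S} → f ∈ T → f ≢ E₁ → f ≢ E₂ → f ∈ S → S ≢ T → ⊥
    third-member-in-no-other-part f∈T f≢E₁ f≢E₂ f∈S S≢T
      with F′.L-neighbour-∋-end T-wAwB (image-~L S≢T (_ , f∈S , f∈T))
    ... | inj₁ wA∈S = ¬meets-both (joins-sym E₁-a₁a₂) E₁∈T f∈T f≢E₁ (T-star f∈T) E₁∈A A≢T A-star
                                  E₁∈A′ A′≢T A′≢A f∈S S≢T
                                  (common-end⇒meet wA∈S wA∈A) (common-end⇒meet wA∈S A′-at-wA)
    ... | inj₂ wB∈S = ¬meets-both E₂-a₂a₃ E₂∈T f∈T f≢E₂ (T-star f∈T) E₂∈B B≢T B-star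
                                  E₂∈B′ B′≢T B′≢B f∈S S≢T
                                  (common-end⇒meet wB∈S wB∈B) (common-end⇒meet wB∈S B′-at-wB)

    contradiction : ⊥
    contradiction with edgePart-or-third (part D T) E₁∈T E₂∈T (proj₁ (joins⇒~L E₁-a₁a₂ E₂-a₂a₃ a₁≢a₃))
    ... | inj₁ T-edge = T-not-edgePart T-edge
    ... | inj₂ (f , f∈T , f≢E₁ , f≢E₂) = ¬¬-excluded-middle λ f-root? →
      let S , S≢T , f∈S = anotherPart f-root? T
      in third-member-in-no-other-part f∈T f≢E₁ f≢E₂ f∈S S≢T

  ¬shortcutFreeWalk₄ : ShortcutFreeWalk₄ → ⊥
  ¬shortcutFreeWalk₄ = Walk.contradiction

module _ (F : Graph) {m : ℕ} (c : Fin (ℕ.suc m) → Fin (n F)) where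

  cycAdjacent? : ∀ i j → Dec (CycAdjacent m i j)
  cycAdjacent? i j = (toℕ j ℕ.≟ ℕ.suc (toℕ i)) ⊎-dec (toℕ i ℕ.≟ ℕ.suc (toℕ j))
                   ⊎-dec ((toℕ i ℕ.≟ m) ×-dec (toℕ j ℕ.≟ 0)) ⊎-dec ((toℕ j ℕ.≟ m) ×-dec (toℕ i ℕ.≟ 0))

  hasChord? : Dec (HasChord F m c)
  hasChord? = any? λ i → any? λ j → ¬? (cycAdjacent? i j) ×-dec (adj F (c i) (c j) Bool.≟ true)

chordless-cycle⇒shortcutFreeWalk₄ : ∀ {F m c} → 3 ℕ.≤ m → IsCycle F m c → ¬ HasChord F m c →
                                     Edges.ShortcutFreeWalk₄ F
chordless-cycle⇒shortcutFreeWalk₄ {F} {m = ℕ.suc (ℕ.suc (ℕ.suc j))} {c} (s≤s (s≤s (s≤s z≤n)))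
                                   (c-injective , c-path , c-closed) ¬chord = record
  { a₀ = c (fromℕ (3 ℕ.+ j)) ; a₁ = c zero ; a₂ = c (suc zero) ; a₃ = c (suc (suc zero)) ; a₄ = c (suc (suc (suc zero)))
  ; a₀~a₁ = c-closed
  ; a₁~a₂ = c-path zero
  ; a₂~a₃ = c-path (suc zero)
  ; a₃~a₄ = c-path (suc (suc zero))
  ; a₀≢a₂ = (λ ()) ∘ c-injective
  ; a₁≢a₃ = (λ ()) ∘ c-injective
  ; a₂≢a₄ = (λ ()) ∘ c-injective
  ; a₀≁a₂ = nonadjacent λ { (inj₁ ()) ; (inj₂ (inj₁ ())) ; (inj₂ (inj₂ (inj₁ (_ , ())))) ; (inj₂ (inj₂ (inj₂ (() , _)))) }
  ; a₁≁a₃ = nonadjacent λ { (inj₁ ()) ; (inj₂ (inj₁ ())) ; (inj₂ (inj₂ (inj₁ (() , _)))) ; (inj₂ (inj₂ (inj₂ (() , _)))) }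
  ; a₂≁a₄ = nonadjacent λ { (inj₁ ()) ; (inj₂ (inj₁ ())) ; (inj₂ (inj₂ (inj₁ (() , _)))) ; (inj₂ (inj₂ (inj₂ (_ , ())))) }
  }
  where
  nonadjacent : ∀ {i i′} → ¬ CycAdjacent (3 ℕ.+ j) i i′ → adj F (c i) (c i′) ≢ true
  nonadjacent ¬cycAdjacent ci~ci′ = ¬chord (_ , _ , ¬cycAdjacent , ci~ci′)

lemma4p9 : (F : Graph) (R : Edge F → Set) → (∀ e → R e → Pendant {F} e) →
    (D : ValidDecomp (L F) R) →
    ∃[ F′ ] Σ (I {L F} {R} D ≅ L F′) (λ φ →
      ∀ i → IsEdgePart (part D i) → Pendant {F′} (Inverse.to (bij φ) i)) →
    Chordal F
lemma4p9 F R roots-pendant D (F′ , φ , edgeParts-pendant) m 3≤m c cycle =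
  decidable-stable (hasChord? F c) λ ¬chord →
    IntersectionGraphIsLineGraph.¬shortcutFreeWalk₄ F R roots-pendant D F′ φ edgeParts-pendant
      (chordless-cycle⇒shortcutFreeWalk₄ 3≤m cycle ¬chord)
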